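{- If $n$ is a positive integer with $n\equiv 2\pmod 6$, then $\left(\frac{n^2-n+1}{3}\right)^2$ divides $n^n-(n-1)^{n-1}$. -}

{-# OPTIONS --safe #-}
module Submission where

-- Write n = 6k + 2, b = n − 1 and m = (n² − n + 1)/3 = 12k² + 6k + 1, so that
-- n² = b + 3m and n³ + 1 = 3(n + 1)m. Modulo m² the binomial theorem keeps only
-- the linear term, so (b + 3m)^b ≡ b^b (1 + 3m), and n⁶ ≡ 1 − 6(n + 1)m gives
-- n^{6k} ≡ 1 − 6k(n + 1)m = 1 − (3m − 3)m ≡ 1 + 3m. As n^n · n^{6k} = n^{2b} = (b + 3m)^b,
-- this says n^n (1 + 3m) ≡ b^b (1 + 3m), and 1 + 3m is a unit modulo m² with inverse 1 − 3m.

module IntegerCongruence where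

  open import Data.Nat as ℕ using (zero; suc)
  import Data.Nat.Properties as ℕ
  open import Data.Nat.Divisibility using (_∣0) renaming (_∣_ to _∣ℕ_)
  open import Data.Integer using (ℤ; +_; -_; _+_; _-_; _*_; _^_; 0ℤ; ∣_∣)
  open import Data.Integer.Properties
    using (+-inverseʳ; *-identityˡ; *-identityʳ; *-assoc; pos-*; ^-zeroˡ; ^-distribˡ-+-*; ^-*-assoc; m-n≡m⊖n; ⊖-≥)
  open import Data.Integer.Divisibility.Signed using (_∣_; divides; ∣⇒∣ᵤ; ∣m∣n⇒∣m+n; ∣m⇒∣-m; ∣m⇒∣m*n; ∣n⇒∣m*n)
  open import Data.Integer.Tactic.RingSolver using (solve-∀)
  import Data.Nat.Tactic.RingSolver as ℕ-Solver
  open import Level using (0ℓ)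
  open import Relation.Binary.Bundles using (Setoid)
  import Relation.Binary.Reasoning.Setoid as ≈-Reasoning
  open import Relation.Binary.PropositionalEquality using (_≡_; refl; sym; trans; cong; cong₂; subst; module ≡-Reasoning)
  open import Relation.Nullary using (yes; no)

  infix 4 _≡_mod_

  -- A record rather than d ∣ x - y, so that x, y and d can be inferred from a congruence.
  record _≡_mod_ (x y d : ℤ) : Set where
    constructor congruent
    field divides-difference : d ∣ x - y

  ≡-mod-reflexive : ∀ {d x y} → x ≡ y → x ≡ y mod d
  ≡-mod-reflexive {x = x} refl = congruent (divides 0ℤ (+-inverseʳ x))

  ≡-mod-refl : ∀ {d x} → x ≡ x mod d
  ≡-mod-refl = ≡-mod-reflexive refl

  ≡-mod-sym : ∀ {d x y} → x ≡ y mod d → y ≡ x mod d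
  ≡-mod-sym {d} {x} {y} (congruent p) = congruent (subst (d ∣_) (negate x y) (∣m⇒∣-m p))
    where
    negate : ∀ x y → - (x - y) ≡ y - x
    negate = solve-∀

  ≡-mod-trans : ∀ {d x y z} → x ≡ y mod d → y ≡ z mod d → x ≡ z mod d
  ≡-mod-trans {d} {x} {y} {z} (congruent p) (congruent q) =
    congruent (subst (d ∣_) (telescope x y z) (∣m∣n⇒∣m+n p q))
    where
    telescope : ∀ x y z → (x - y) + (y - z) ≡ x - z
    telescope = solve-∀

  ≡-mod-setoid : ℤ → Setoid 0ℓ 0ℓ
  ≡-mod-setoid d = record
    { _≈_           = _≡_mod d
    ; isEquivalence = record { refl = ≡-mod-refl ; sym = ≡-mod-sym ; trans = ≡-mod-trans }
    }

  ≡-mod-+-multiple : ∀ {d} x q → x + q * d ≡ x mod d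
  ≡-mod-+-multiple {d} x q = congruent (divides q (cancel x q d))
    where
    cancel : ∀ x q d → x + q * d - x ≡ q * d
    cancel = solve-∀

  ≡-mod-*-cong : ∀ {d x x′ y y′} → x ≡ x′ mod d → y ≡ y′ mod d → x * y ≡ x′ * y′ mod d
  ≡-mod-*-cong {d} {x} {x′} {y} {y′} (congruent p) (congruent q) =
    congruent (subst (d ∣_) (sym (split x x′ y y′)) (∣m∣n⇒∣m+n (∣m⇒∣m*n y p) (∣n⇒∣m*n x′ q)))
    where
    split : ∀ x x′ y y′ → x * y - x′ * y′ ≡ (x - x′) * y + x′ * (y - y′)
    split = solve-∀

  ≡-mod-*-congˡ : ∀ {d} z {x y} → x ≡ y mod d → z * x ≡ z * y mod d
  ≡-mod-*-congˡ z = ≡-mod-*-cong (≡-mod-refl {x = z})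

  ≡-mod-*-congʳ : ∀ {d} z {x y} → x ≡ y mod d → x * z ≡ y * z mod d
  ≡-mod-*-congʳ z p = ≡-mod-*-cong p (≡-mod-refl {x = z})

  ≡-mod-cancelʳ : ∀ {d u v x y} → u * v ≡ + 1 mod d → x * u ≡ y * u mod d → x ≡ y mod d
  ≡-mod-cancelʳ {d} {u} {v} {x} {y} uv≡1 xu≡yu = begin
    x           ≡⟨ *-identityʳ x ⟨
    x * + 1     ≈⟨ ≡-mod-*-congˡ x uv≡1 ⟨
    x * (u * v) ≡⟨ *-assoc x u v ⟨
    x * u * v   ≈⟨ ≡-mod-*-congʳ v xu≡yu ⟩
    y * u * v   ≡⟨ *-assoc y u v ⟩
    y * (u * v) ≈⟨ ≡-mod-*-congˡ y uv≡1 ⟩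
    y * + 1     ≡⟨ *-identityʳ y ⟩
    y           ∎
    where open ≈-Reasoning (≡-mod-setoid d)

  binomial-mod² : ∀ x d y j → (x + d * y) ^ suc j ≡ x ^ j * (x + + suc j * d * y) mod d * d
  binomial-mod² x d y zero = ≡-mod-reflexive (first x d y)
    where
    first : ∀ x d y → (x + d * y) * + 1 ≡ + 1 * (x + + 1 * d * y)
    first = solve-∀
  binomial-mod² x d y (suc j) = begin
    (x + d * y) * (x + d * y) ^ suc j
      ≈⟨ ≡-mod-*-congˡ (x + d * y) (binomial-mod² x d y j) ⟩
    (x + d * y) * (x ^ j * (x + + suc j * d * y))
      ≡⟨ expand x d y (x ^ j) (+ j) ⟩
    x ^ suc j * (x + + suc (suc j) * d * y) + y * y * + suc j * x ^ j * (d * d)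
      ≈⟨ ≡-mod-+-multiple _ (y * y * + suc j * x ^ j) ⟩
    x ^ suc j * (x + + suc (suc j) * d * y)
      ∎
    where
    open ≈-Reasoning (≡-mod-setoid (d * d))
    -- Stated for J = + j, since + suc j unfolds to + 1 + + j.
    expand : ∀ x d y P J → (x + d * y) * (P * (x + (+ 1 + J) * d * y))
                         ≡ x * P * (x + (+ 1 + (+ 1 + J)) * d * y) + y * y * (+ 1 + J) * P * (d * d)
    expand = solve-∀

  one+binomial-mod² : ∀ d y j → (+ 1 + d * y) ^ j ≡ + 1 + + j * d * y mod d * d
  one+binomial-mod² d y zero = ≡-mod-refl
  one+binomial-mod² d y (suc j) = begin
    (+ 1 + d * y) ^ suc j                 ≈⟨ binomial-mod² (+ 1) d y j ⟩
    (+ 1) ^ j * (+ 1 + + suc j * d * y)   ≡⟨ cong (_* (+ 1 + + suc j * d * y)) (^-zeroˡ j) ⟩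
    + 1 * (+ 1 + + suc j * d * y)         ≡⟨ *-identityˡ _ ⟩
    + 1 + + suc j * d * y                 ∎
    where open ≈-Reasoning (≡-mod-setoid (d * d))

  n⁶≡1+mt[mt-2] : ∀ {n m t} → n ^ 3 + + 1 ≡ m * t → n ^ 6 ≡ + 1 + m * (t * (m * t - + 2))
  n⁶≡1+mt[mt-2] {n} {m} {t} n³+1≡mt = begin
    n ^ 6                          ≡⟨ ^-*-assoc n 3 2 ⟨
    (n ^ 3) ^ 2                    ≡⟨ cong (_^ 2) n³≡mt-1 ⟩
    (m * t - + 1) ^ 2              ≡⟨ expand m t ⟩
    + 1 + m * (t * (m * t - + 2))  ∎
    where
    open ≡-Reasoning
    shift : ∀ z → z ≡ z + + 1 - + 1
    shift = solve-∀
    n³≡mt-1 : n ^ 3 ≡ m * t - + 1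
    n³≡mt-1 = trans (shift (n ^ 3)) (cong (_- + 1) n³+1≡mt)
    -- The ring solver does not know ℤ's _^_, so x ^ 2 is written unfolded as x * (x * + 1).
    expand : ∀ m t → (m * t - + 1) * ((m * t - + 1) * + 1) ≡ + 1 + m * (t * (m * t - + 2))
    expand = solve-∀

  1+kmt[mt-2]≡1+3m : ∀ k {m t} → k * (+ 2 * t) + + 3 ≡ m * + 3 →
    + 1 + k * m * (t * (m * t - + 2)) ≡ + 1 + m * + 3 mod m * m
  1+kmt[mt-2]≡1+3m k {m} {t} 2kt+3≡3m = ≡-mod-trans (≡-mod-reflexive regroup) (≡-mod-+-multiple _ (k * t * t - + 3))
    where
    open ≡-Reasoning
    isolate : ∀ k m t → + 1 + k * m * (t * (m * t - + 2)) ≡ + 1 + k * t * t * (m * m) - m * (k * (+ 2 * t) + + 3 - + 3)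
    isolate = solve-∀
    collect : ∀ k m t → + 1 + k * t * t * (m * m) - m * (m * + 3 - + 3) ≡ + 1 + m * + 3 + (k * t * t - + 3) * (m * m)
    collect = solve-∀
    regroup : + 1 + k * m * (t * (m * t - + 2)) ≡ + 1 + m * + 3 + (k * t * t - + 3) * (m * m)
    regroup = begin
      + 1 + k * m * (t * (m * t - + 2))
        ≡⟨ isolate k m t ⟩
      + 1 + k * t * t * (m * m) - m * (k * (+ 2 * t) + + 3 - + 3)
        ≡⟨ cong (λ z → + 1 + k * t * t * (m * m) - m * (z - + 3)) 2kt+3≡3m ⟩
      + 1 + k * t * t * (m * m) - m * (m * + 3 - + 3)
        ≡⟨ collect k m t ⟩
      + 1 + m * + 3 + (k * t * t - + 3) * (m * m)
        ∎

  n^[6k]≡1+3m : ∀ k {n m t} → n ^ 3 + + 1 ≡ m * t → + k * (+ 2 * t) + + 3 ≡ m * + 3 →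
    n ^ (k ℕ.* 6) ≡ + 1 + m * + 3 mod m * m
  n^[6k]≡1+3m k {n} {m} {t} n³+1≡mt 2kt+3≡3m = begin
    n ^ (k ℕ.* 6)                            ≡⟨ cong (n ^_) (ℕ.*-comm k 6) ⟩
    n ^ (6 ℕ.* k)                            ≡⟨ ^-*-assoc n 6 k ⟨
    (n ^ 6) ^ k                              ≡⟨ cong (_^ k) (n⁶≡1+mt[mt-2] {n} {m} {t} n³+1≡mt) ⟩
    (+ 1 + m * (t * (m * t - + 2))) ^ k      ≈⟨ one+binomial-mod² m _ k ⟩
    + 1 + + k * m * (t * (m * t - + 2))      ≈⟨ 1+kmt[mt-2]≡1+3m (+ k) 2kt+3≡3m ⟩
    + 1 + m * + 3                            ∎
    where open ≈-Reasoning (≡-mod-setoid (m * m))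

  [b+3m]^b≡b^b[1+3m] : ∀ j {b m} → b ≡ + suc j → (b + m * + 3) ^ suc j ≡ b ^ suc j * (+ 1 + m * + 3) mod m * m
  [b+3m]^b≡b^b[1+3m] j {b} {m} refl = begin
    (b + m * + 3) ^ suc j              ≈⟨ binomial-mod² b m (+ 3) j ⟩
    b ^ j * (b + b * m * + 3)          ≡⟨ factor b (b ^ j) m ⟩
    b * b ^ j * (+ 1 + m * + 3)        ∎
    where
    open ≈-Reasoning (≡-mod-setoid (m * m))
    factor : ∀ b P m → P * (b + b * m * + 3) ≡ b * P * (+ 1 + m * + 3)
    factor = solve-∀

  1+3m-unit : ∀ m → (+ 1 + m * + 3) * (+ 1 - m * + 3) ≡ + 1 mod m * m
  1+3m-unit m = ≡-mod-trans (≡-mod-reflexive (difference-of-squares m)) (≡-mod-+-multiple _ (- + 9))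
    where
    difference-of-squares : ∀ m → (+ 1 + m * + 3) * (+ 1 - m * + 3) ≡ + 1 + - + 9 * (m * m)
    difference-of-squares = solve-∀

  n^n≡b^b-mod-m² : ∀ k {n b m t} →
    b ≡ + suc (k ℕ.* 6) →
    n ^ 2 ≡ b + m * + 3 →
    n ^ 3 + + 1 ≡ m * t →
    + k * (+ 2 * t) + + 3 ≡ m * + 3 →
    n ^ (2 ℕ.+ k ℕ.* 6) ≡ b ^ suc (k ℕ.* 6) mod m * m
  n^n≡b^b-mod-m² k {n} {b} {m} {t} b≡6k+1 n²≡b+3m n³+1≡mt 2kt+3≡3m =
    ≡-mod-cancelʳ (1+3m-unit m) (begin
      n ^ (2 ℕ.+ j) * (+ 1 + m * + 3) ≈⟨ ≡-mod-*-congˡ (n ^ (2 ℕ.+ j)) (n^[6k]≡1+3m k {n} {m} {t} n³+1≡mt 2kt+3≡3m) ⟨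
      n ^ (2 ℕ.+ j) * n ^ j           ≡⟨ ^-distribˡ-+-* n (2 ℕ.+ j) j ⟨
      n ^ (2 ℕ.+ j ℕ.+ j)             ≡⟨ cong (n ^_) (exponents k) ⟩
      n ^ (2 ℕ.* suc j)               ≡⟨ ^-*-assoc n 2 (suc j) ⟨
      (n ^ 2) ^ suc j                 ≡⟨ cong (_^ suc j) n²≡b+3m ⟩
      (b + m * + 3) ^ suc j           ≈⟨ [b+3m]^b≡b^b[1+3m] j {b} {m} b≡6k+1 ⟩
      b ^ suc j * (+ 1 + m * + 3)     ∎)
    where
    j = k ℕ.* 6
    open ≈-Reasoning (≡-mod-setoid (m * m))
    exponents : ∀ k → 2 ℕ.+ k ℕ.* 6 ℕ.+ k ℕ.* 6 ≡ 2 ℕ.* suc (k ℕ.* 6)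
    exponents = ℕ-Solver.solve-∀

  ≡-mod-resp : ∀ {x x′ y y′ d d′} → x ≡ x′ → y ≡ y′ → d ≡ d′ → x′ ≡ y′ mod d′ → x ≡ y mod d
  ≡-mod-resp refl refl refl p = p

  pos-^ : ∀ a e → + (a ℕ.^ e) ≡ (+ a) ^ e
  pos-^ a zero    = refl
  pos-^ a (suc e) = trans (pos-* a (a ℕ.^ e)) (cong (+ a *_) (pos-^ a e))

  ≡-mod⇒∣∸ : ∀ {x y d} → + x ≡ + y mod + d → d ∣ℕ x ℕ.∸ y
  ≡-mod⇒∣∸ {x} {y} {d} (congruent p) with y ℕ.≤? x
  ... | yes y≤x = subst (d ∣ℕ_) (cong ∣_∣ (trans (m-n≡m⊖n x y) (⊖-≥ y≤x))) (∣⇒∣ᵤ p)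
  ... | no  y≰x = subst (d ∣ℕ_) (sym (ℕ.m≤n⇒m∸n≡0 (ℕ.≰⇒≥ y≰x))) (d ∣0)

  m²∣n^n∸b^b : ∀ k →
    (1 ℕ.+ k ℕ.* 6 ℕ.+ k ℕ.* k ℕ.* 12) ℕ.^ 2 ∣ℕ
      (2 ℕ.+ k ℕ.* 6) ℕ.^ (2 ℕ.+ k ℕ.* 6) ℕ.∸ (1 ℕ.+ k ℕ.* 6) ℕ.^ (1 ℕ.+ k ℕ.* 6)
  m²∣n^n∸b^b k = ≡-mod⇒∣∸ (≡-mod-resp (pos-^-self n n-as-polynomial) (pos-^-self b b-as-polynomial) m²-as-polynomial
    (n^n≡b^b-mod-m² k {N} {B} {M} {T} (sym b-as-polynomial) (n² K) (n³+1 K) (2kt+3 K)))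
    where
    n = 2 ℕ.+ k ℕ.* 6
    b = 1 ℕ.+ k ℕ.* 6
    m = 1 ℕ.+ k ℕ.* 6 ℕ.+ k ℕ.* k ℕ.* 12
    K = + k
    N = + 2 + K * + 6
    B = + 1 + K * + 6
    M = + 1 + K * + 6 + K * K * + 12
    T = + 9 + K * + 18
    pos-^-self : ∀ a {A} → + a ≡ A → + (a ℕ.^ a) ≡ A ^ a
    pos-^-self a a≡A = trans (pos-^ a a) (cong (_^ a) a≡A)
    n-as-polynomial : + n ≡ N
    n-as-polynomial = cong (_+_ (+ 2)) (pos-* k 6)
    b-as-polynomial : + b ≡ B
    b-as-polynomial = cong (_+_ (+ 1)) (pos-* k 6)
    m-as-polynomial : + m ≡ M
    m-as-polynomial = cong₂ _+_ b-as-polynomial (trans (pos-* (k ℕ.* k) 12) (cong (_* + 12) (pos-* k k)))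
    m²-as-polynomial : + (m ℕ.^ 2) ≡ M * M
    m²-as-polynomial = trans (cong (λ z → + (m ℕ.* z)) (ℕ.*-identityʳ m))
      (trans (pos-* m m) (cong₂ _*_ m-as-polynomial m-as-polynomial))
    n² : ∀ K → (+ 2 + K * + 6) * ((+ 2 + K * + 6) * + 1) ≡ (+ 1 + K * + 6) + (+ 1 + K * + 6 + K * K * + 12) * + 3
    n² = solve-∀
    n³+1 : ∀ K → (+ 2 + K * + 6) * ((+ 2 + K * + 6) * ((+ 2 + K * + 6) * + 1)) + + 1 ≡ (+ 1 + K * + 6 + K * K * + 12) * (+ 9 + K * + 18)
    n³+1 = solve-∀
    2kt+3 : ∀ K → K * (+ 2 * (+ 9 + K * + 18)) + + 3 ≡ (+ 1 + K * + 6 + K * K * + 12) * + 3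
    2kt+3 = solve-∀

open import Data.Nat using (ℕ; _+_; _*_; _∸_; _^_; _<_)
open import Data.Nat.Properties using (m+n∸n≡m)
open import Data.Nat.DivMod using (_/_; _%_; m≡m%n+[m/n]*n; m*n/n≡m)
open import Data.Nat.Divisibility using (_∣_)
open import Data.Nat.Tactic.RingSolver using (solve-∀)
open import Relation.Binary.PropositionalEquality using (_≡_; sym; trans; cong; subst; module ≡-Reasoning)
open IntegerCongruence using (m²∣n^n∸b^b)

n²∸n+1≡3m : ∀ k → (2 + k * 6) * (2 + k * 6) ∸ (2 + k * 6) + 1 ≡ (1 + k * 6 + k * k * 12) * 3
n²∸n+1≡3m k = begin
  n * n ∸ n + 1                ≡⟨ cong (λ z → z ∸ n + 1) (square k) ⟩
  r + n ∸ n + 1                ≡⟨ cong (_+ 1) (m+n∸n≡m r n) ⟩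
  r + 1                        ≡⟨ triple k ⟩
  (1 + k * 6 + k * k * 12) * 3 ∎
  where
  open ≡-Reasoning
  n = 2 + k * 6
  r = 2 + k * 18 + k * k * 36
  square : ∀ k → (2 + k * 6) * (2 + k * 6) ≡ 2 + k * 18 + k * k * 36 + (2 + k * 6)
  square = solve-∀
  triple : ∀ k → 2 + k * 18 + k * k * 36 + 1 ≡ (1 + k * 6 + k * k * 12) * 3
  triple = solve-∀

[n²∸n+1]/3≡m : ∀ k → ((2 + k * 6) * (2 + k * 6) ∸ (2 + k * 6) + 1) / 3 ≡ 1 + k * 6 + k * k * 12
[n²∸n+1]/3≡m k = trans (cong (_/ 3) (n²∸n+1≡3m k)) (m*n/n≡m _ 3)

proposition4p3 : (n : ℕ) → 0 < n → n % 6 ≡ 2 →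
    ((n * n ∸ n + 1) / 3) ^ 2 ∣ (n ^ n ∸ (n ∸ 1) ^ (n ∸ 1))
proposition4p3 n _ n%6≡2 = subst Claim (sym n≡2+6k) claim
  where
  k = n / 6
  Claim : ℕ → Set
  Claim x = ((x * x ∸ x + 1) / 3) ^ 2 ∣ (x ^ x ∸ (x ∸ 1) ^ (x ∸ 1))
  n≡2+6k : n ≡ 2 + k * 6
  n≡2+6k = trans (m≡m%n+[m/n]*n n 6) (cong (_+ k * 6) n%6≡2)
  claim : Claim (2 + k * 6)
  claim = subst (λ d → d ^ 2 ∣ (2 + k * 6) ^ (2 + k * 6) ∸ (1 + k * 6) ^ (1 + k * 6))
                (sym ([n²∸n+1]/3≡m k)) (m²∣n^n∸b^b k)
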